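{- Let $n\ge6$ and let $k$ be a nontrivial divisor of $n$ (i.e., $k\mid n$ and $1<k<n$). Then $k!\left(\left(\frac nk\right)!\right)^k<(n-1)!$. -}

{-# OPTIONS --safe #-}
module Submission where

-- Write n = m k with m, k ≥ 2 and put B(k, m) = k! (m!)^k.  Passing from m to m + 1
-- multiplies B by (m + 1)^k and (mk − 1)! by the k factors mk, …, mk + k − 1, each at
-- least m + 1; passing from k to k + 1 at m = 2 multiplies B by 2(k + 1) and (2k − 1)!
-- by 2k (2k + 1).  So the strict inequality propagates upwards from the two base cases
-- (k, m) = (3, 2) and (2, 3), which together cover every pair with mk ≥ 6.

open import Data.Nat
open import Data.Nat.Properties
open import Data.Nat.DivMod using (_/_; m*n/n≡m)
open import Data.Nat.Divisibility using (_∣_; divides)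
open import Data.Nat.Solver using (module +-*-Solver)
open import Function using (_∘_; id)
open import Relation.Binary.PropositionalEquality
open import Relation.Nullary.Decidable using (toWitness)

open +-*-Solver

^-distribʳ-* : ∀ m n p → (m * n) ^ p ≡ m ^ p * n ^ p
^-distribʳ-* m n zero    = refl
^-distribʳ-* m n (suc p) rewrite ^-distribʳ-* m n p =
  solve 4 (λ a b c d → (a :* b) :* (c :* d) := (a :* c) :* (b :* d)) refl m n (m ^ p) (n ^ p)

m∸1+n≡m+n∸1 : ∀ m n → 1 ≤ m → (m ∸ 1) + n ≡ m + n ∸ 1
m∸1+n≡m+n∸1 m n 1≤m = sym (+-∸-comm n 1≤m)

ascProd : ℕ → ℕ → ℕ
ascProd x zero    = 1
ascProd x (suc j) = suc (x + j) * ascProd x j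

!-+-ascProd : ∀ x j → (x + j) ! ≡ x ! * ascProd x j
!-+-ascProd x zero    rewrite +-identityʳ x = sym (*-identityʳ (x !))
!-+-ascProd x (suc j) rewrite +-suc x j | !-+-ascProd x j =
  solve 3 (λ a b c → a :* (b :* c) := b :* (a :* c)) refl (suc (x + j)) (x !) (ascProd x j)

ascProd-2 : ∀ x → ascProd x 2 ≡ suc (suc x) * suc x
ascProd-2 x = solve 1
  (λ a → (con 1 :+ (a :+ con 1)) :* ((con 1 :+ (a :+ con 0)) :* con 1) := (con 2 :+ a) :* (con 1 :+ a))
  refl x

^≤ascProd : ∀ {c x} j → c ≤ suc x → c ^ j ≤ ascProd x j
^≤ascProd zero    c≤1+x = ≤-refl
^≤ascProd {x = x} (suc j) c≤1+x =
  *-mono-≤ (≤-trans c≤1+x (s≤s (m≤m+n x j))) (^≤ascProd j c≤1+x)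

*-<-!-+ : ∀ {A x} a j .{{_ : NonZero a}} → A < x ! → a ≤ ascProd x j → A * a < (x + j) !
*-<-!-+ {A} {x} a j A<x! a≤ascProd = begin-strict
  A * a             <⟨ *-monoˡ-< a A<x! ⟩
  x ! * a           ≤⟨ *-monoʳ-≤ (x !) a≤ascProd ⟩
  x ! * ascProd x j ≡⟨ sym (!-+-ascProd x j) ⟩
  (x + j) !         ∎
  where open ≤-Reasoning

B : ℕ → ℕ → ℕ
B k m = k ! * (m !) ^ k

Bounded : ℕ → ℕ → Set
Bounded k m = B k m < (m * k ∸ 1) !

B-sucʳ : ∀ k m → B k (suc m) ≡ B k m * suc m ^ k
B-sucʳ k m rewrite ^-distribʳ-* (suc m) (m !) k =
  solve 3 (λ a b c → a :* (b :* c) := (a :* c) :* b) refl (k !) (suc m ^ k) ((m !) ^ k)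

B-sucˡ-2 : ∀ k → B (suc k) 2 ≡ B k 2 * (2 * suc k)
B-sucˡ-2 k =
  solve 3 (λ a b u → (a :* b) :* (con 2 :* u) := (b :* u) :* (con 2 :* a)) refl (suc k) (k !) (2 ^ k)

Bounded-sucʳ : ∀ {k m} → 2 ≤ k → 1 ≤ m → Bounded k m → Bounded k (suc m)
Bounded-sucʳ {k} {m} 2≤k 1≤m bounded =
  subst₂ _<_ (sym (B-sucʳ k m))
    (cong _! (trans (m∸1+n≡m+n∸1 (m * k) k 1≤mk) (cong (_∸ 1) (+-comm (m * k) k))))
    (*-<-!-+ (suc m ^ k) k {{m^n≢0 (suc m) k}} bounded (^≤ascProd k 1+m≤mk))
  where
  1≤mk : 1 ≤ m * k
  1≤mk = *-mono-≤ 1≤m (≤-trans (s≤s z≤n) 2≤k)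
  1+m≤mk : suc m ≤ suc (m * k ∸ 1)
  1+m≤mk = begin-strict
    m                <⟨ m<m+n m 1≤m ⟩
    m + m            ≡⟨ solve 1 (λ a → a :+ a := a :* con 2) refl m ⟩
    m * 2            ≤⟨ *-monoʳ-≤ m 2≤k ⟩
    m * k            ≡⟨ sym (suc-pred (m * k) {{>-nonZero 1≤mk}}) ⟩
    suc (m * k ∸ 1)  ∎
    where open ≤-Reasoning

Bounded-sucˡ-2 : ∀ {k} → 1 ≤ k → Bounded k 2 → Bounded (suc k) 2
Bounded-sucˡ-2 {k} 1≤k bounded =
  subst₂ _<_ (sym (B-sucˡ-2 k))
    (cong _! (trans (m∸1+n≡m+n∸1 (2 * k) 2 1≤2k) (cong (_∸ 1) 2k+2≡2[1+k])))
    (*-<-!-+ {x = 2 * k ∸ 1} (2 * suc k) 2 bounded 2[1+k]≤ascProd)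
  where
  2≤2k : 2 ≤ 2 * k
  2≤2k = *-monoʳ-≤ 2 1≤k
  1≤2k : 1 ≤ 2 * k
  1≤2k = ≤-trans (s≤s z≤n) 2≤2k
  2k+2≡2[1+k] : 2 * k + 2 ≡ 2 * suc k
  2k+2≡2[1+k] = trans (+-comm (2 * k) 2) (sym (*-suc 2 k))
  2[1+k]≤ascProd : 2 * suc k ≤ ascProd (2 * k ∸ 1) 2
  2[1+k]≤ascProd = begin
    2 * suc k                ≡⟨ *-comm 2 (suc k) ⟩
    suc k * 2                ≤⟨ *-mono-≤ (s≤s (m≤m+n k (k + 0))) 2≤2k ⟩
    suc (2 * k) * (2 * k)    ≡⟨ cong (λ y → suc y * y) (sym (suc-pred (2 * k) {{>-nonZero 1≤2k}})) ⟩
    suc (suc x) * suc x      ≡⟨ sym (ascProd-2 x) ⟩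
    ascProd x 2              ∎
    where
    open ≤-Reasoning
    x = 2 * k ∸ 1

Bounded-3-2 : Bounded 3 2
Bounded-3-2 = toWitness {a? = B 3 2 <? 5 !} _

Bounded-2-3 : Bounded 2 3
Bounded-2-3 = toWitness {a? = B 2 3 <? 5 !} _

Bounded-monoʳ : ∀ {k m m′} → 2 ≤ k → 1 ≤ m → m ≤′ m′ → Bounded k m → Bounded k m′
Bounded-monoʳ 2≤k 1≤m ≤′-refl         = id
Bounded-monoʳ 2≤k 1≤m (≤′-step m≤′m′) =
  Bounded-sucʳ 2≤k (≤-trans 1≤m (≤′⇒≤ m≤′m′)) ∘ Bounded-monoʳ 2≤k 1≤m m≤′m′

Bounded-2 : ∀ {k} → 3 ≤′ k → Bounded k 2
Bounded-2 ≤′-refl         = Bounded-3-2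
Bounded-2 (≤′-step 3≤′k) = Bounded-sucˡ-2 (≤-trans (s≤s z≤n) (≤′⇒≤ 3≤′k)) (Bounded-2 3≤′k)

bounded : ∀ {k m} → 2 ≤ k → 2 ≤ m → 6 ≤ m * k → Bounded k m
bounded {2} {2} _ _ (s≤s (s≤s (s≤s (s≤s ()))))
bounded {2} {m@(suc (suc (suc _)))} 2≤k _ _ =
  Bounded-monoʳ {m′ = m} 2≤k (s≤s z≤n) (≤⇒≤′ (s≤s (s≤s (s≤s z≤n)))) Bounded-2-3
bounded {k@(suc (suc (suc _)))} {m} 2≤k 2≤m _ =
  Bounded-monoʳ {k} {m′ = m} 2≤k (s≤s z≤n) (≤⇒≤′ 2≤m) (Bounded-2 {k} (≤⇒≤′ (s≤s (s≤s (s≤s z≤n)))))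
bounded {1} (s≤s ())
bounded {2} {1} _ (s≤s ())

lemma2p8 : (n k : ℕ) → .{{_ : NonZero k}} → 6 ≤ n → k ∣ n → 1 < k → k < n →
    k ! * ((n / k) !) ^ k < (n ∸ 1) !
lemma2p8 n k {{k≢0}} 6≤n (divides m refl) 1<k k<n rewrite m*n/n≡m m k {{k≢0}} =
  bounded 1<k 1<m 6≤n
  where
  1<m : 1 < m
  1<m = *-cancelʳ-< k 1 m (subst (_< m * k) (sym (*-identityˡ k)) k<n)
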